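{- Let $k\ge 1$ and $n\ge 3$ be integers. Then $\mu_k(P_n)=2$ for every $k$ at most the diameter of $P_n$, and, for every $k$ at most the diameter of $C_n$, $$\mu_k(C_n)=\begin{cases}3 & \text{if } n\le 3k,\\ 2 & \text{otherwise.}\end{cases}$$
   Context: $P_n$ and $C_n$ denote the path and the cycle on $n$ vertices. For a graph $G$, a set $S\subseteq V(G)$ and an integer $k\ge 1$, two vertices $x,y$ are $S_k$-visible if there is a shortest $x,y$-path of length at most $k$ none of whose internal vertices lies in $S$. $S$ is a $k$-distance mutual-visibility set if every two vertices of $S$ are $S_k$-visible, and $\mu_k(G)$ is the maximum cardinality of such a set. -}

module Defs where

open import Data.Nat using (ℕ; zero; suc; _∸_; _≤_; _<_)
open import Data.Fin using (Fin; toℕ)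
open import Data.Fin.Subset using (Subset; _∈_; _∉_; ∣_∣)
open import Data.Product using (Σ; ∃; _×_; _,_)
open import Data.Sum using (_⊎_)
open import Data.Unit using (⊤)
open import Relation.Nullary using (¬_)
open import Relation.Binary.PropositionalEquality using (_≡_; _≢_)

Graph : ℕ → Set₁
Graph n = Fin n → Fin n → Set

PathG : (n : ℕ) → Graph n
PathG n i j = toℕ j ≡ suc (toℕ i) ⊎ toℕ i ≡ suc (toℕ j)

CycleG : (n : ℕ) → Graph n
CycleG n i j = PathG n i j
             ⊎ (toℕ i ≡ 0 × toℕ j ≡ n ∸ 1)
             ⊎ (toℕ j ≡ 0 × toℕ i ≡ n ∸ 1)

data Walk {n : ℕ} (G : Graph n) : Fin n → Fin n → ℕ → Set where
  [] : ∀ x → Walk G x x 0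
  _∷_ : ∀ {x y z l} → G x y → Walk G y z l → Walk G x z (suc l)

AvoidsInternal : ∀ {n} {G : Graph n} {x y l} → Subset n → Walk G x y l → Set
AvoidsInternal S ([] _) = ⊤
AvoidsInternal S (e ∷ [] _) = ⊤
AvoidsInternal S (_∷_ {y = v} e (e' ∷ w)) = v ∉ S × AvoidsInternal S (e' ∷ w)

Dist : ∀ {n} → Graph n → Fin n → Fin n → ℕ → Set
Dist G x y d = Walk G x y d × (∀ l → l < d → ¬ Walk G x y l)

-- x,y are S_k-visible: some shortest x,y-path of length ≤ k has no internal vertex in S.
-- (A walk of length d_G(x,y) is exactly a shortest path.)
Visible : ∀ {n} → Graph n → Subset n → ℕ → Fin n → Fin n → Set
Visible G S k x y =
  Σ ℕ λ l → Σ (Walk G x y l) λ w → Dist G x y l × l ≤ k × AvoidsInternal S w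

IsKDistMutVis : ∀ {n} → Graph n → ℕ → Subset n → Set
IsKDistMutVis G k S = ∀ x y → x ∈ S → y ∈ S → x ≢ y → Visible G S k x y

IsMuK : ∀ {n} → Graph n → ℕ → ℕ → Set
IsMuK {n} G k m =
  (Σ (Subset n) λ S → IsKDistMutVis G k S × ∣ S ∣ ≡ m)
  × (∀ (S : Subset n) → IsKDistMutVis G k S → ∣ S ∣ ≤ m)

IsDiameter : ∀ {n} → Graph n → ℕ → Set
IsDiameter {n} G D =
  (∀ x y → Σ ℕ λ d → Dist G x y d × d ≤ D)
  × (Σ (Fin n) λ x → Σ (Fin n) λ y → Dist G x y D)

-- On a path, a vertex strictly between two others lies on every walk joining them, so no three
-- vertices are mutually visible, while two adjacent ones are.  On a cycle, two vertices separating
-- a from c (one on each side) block every a,c-walk in the same way, so no four vertices are mutually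
-- visible.  Three vertices a < b < c can only see each other along the three arcs they cut out, each
-- walk avoiding the third vertex; reading positions on the cycle cut open at that vertex, the three
-- walks together gain at least n, whence n ≤ 3k.  Conversely, if n ≤ 3k, cut the cycle into three
-- arcs of lengths between 1 and k: as k ≤ diam ≤ n/2 each arc is a shortest path, so its endpoints
-- are mutually visible.

module Submission where

open import Defs
open import Data.Nat using (ℕ; _≤_; _*_)
open import Data.Product using (_×_)
open import Relation.Nullary using (¬_)

open import Data.Nat using (zero; suc; _+_; _∸_; _<_; z≤n; s≤s; ∣_-_∣)
open import Data.Nat.Properties
open import Data.Fin using (Fin; toℕ; fromℕ; fromℕ<)
open import Data.Fin.Properties using (toℕ-injective; toℕ<n; toℕ-fromℕ; toℕ-fromℕ<)
  renaming (_≟_ to _≟ᶠ_; <⇒≢ to <⇒≢ᶠ)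
open import Data.Fin.Subset using (Subset; _∈_; _∉_; inside; outside; ⁅_⁆; _∪_; ⊥; ∣_∣) renaming (_-_ to _∖_)
open import Data.Fin.Subset.Properties
  using (x∈p⇒∣p-x∣<∣p∣; x∈p∧x≢y⇒x∈p-y; ∉⊥; x∈⁅x⁆; x∈⁅y⁆⇒x≡y; x∈p∪q⁻; x∈p∪q⁺; ∣⊥∣≡0)
open import Data.Vec.Base using (here; there; _∷_; [])
open import Data.Product using (Σ; ∃; _,_; proj₁; proj₂)
open import Data.Sum using (_⊎_; inj₁; inj₂; [_,_]′)
import Data.Sum as Sum
open import Data.Unit using (tt)
open import Function using (_∘_)
open import Relation.Nullary using (yes; no; contradiction)
open import Relation.Binary.Definitions using (Symmetric)
open import Relation.Binary.PropositionalEquality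
  using (_≡_; _≢_; refl; sym; trans; cong; cong₂; subst; subst₂; module ≡-Reasoning)
open import Algebra.Properties.CommutativeSemigroup +-commutativeSemigroup using (x∙yz≈y∙xz)

private
  variable
    n l l′ k d : ℕ
    G : Graph n
    S : Subset n
    x y z v : Fin n

_∷ʳ_ : Walk G x y l → G y z → Walk G x z (suc l)
[] _ ∷ʳ e = e ∷ [] _
(e′ ∷ w) ∷ʳ e = e′ ∷ (w ∷ʳ e)

_++_ : Walk G x y l → Walk G y z l′ → Walk G x z (l + l′)
[] _ ++ w′ = w′
(e ∷ w) ++ w′ = e ∷ (w ++ w′)

reverse : Symmetric G → Walk G x y l → Walk G y x l
reverse G-sym ([] x) = [] x
reverse G-sym (e ∷ w) = reverse G-sym w ∷ʳ G-sym e

avoids-∷ : (e : G x v) (w : Walk G v y l) → (l ≢ 0 → v ∉ S) → AvoidsInternal S w →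
           AvoidsInternal S (e ∷ w)
avoids-∷ e ([] _) _ _ = tt
avoids-∷ e (_ ∷ _) v∉S av = v∉S (λ ()) , av

avoids-∷ʳ : (w : Walk G x y l) (e : G y z) → (l ≢ 0 → y ∉ S) → AvoidsInternal S w →
            AvoidsInternal S (w ∷ʳ e)
avoids-∷ʳ ([] _) e _ _ = tt
avoids-∷ʳ (_ ∷ [] _) e y∉S _ = y∉S (λ ()) , tt
avoids-∷ʳ (_ ∷ w@(_ ∷ _)) e y∉S (v∉S , av) = v∉S , avoids-∷ʳ w e (λ _ → y∉S (λ ())) av

reverse-avoids : (G-sym : Symmetric G) (w : Walk G x y l) → AvoidsInternal S w →
                 AvoidsInternal S (reverse G-sym w)
reverse-avoids G-sym ([] _) _ = tt
reverse-avoids G-sym (_ ∷ [] _) _ = tt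
reverse-avoids G-sym (e ∷ w@(_ ∷ _)) (v∉S , av) =
  avoids-∷ʳ (reverse G-sym w) (G-sym e) (λ _ → v∉S) (reverse-avoids G-sym w av)

Dist-sym : Symmetric G → Dist G x y d → Dist G y x d
Dist-sym G-sym (w , minimal) = reverse G-sym w , λ l l<d w′ → minimal l l<d (reverse G-sym w′)

Visible-sym : Symmetric G → Visible G S k x y → Visible G S k y x
Visible-sym G-sym (l , w , dist , l≤k , av) =
  l , reverse G-sym w , Dist-sym G-sym dist , l≤k , reverse-avoids G-sym w av

Dist⇒≤-length : Dist G x y d → Walk G x y l → d ≤ l
Dist⇒≤-length (_ , minimal) w = ≮⇒≥ (λ l<d → minimal _ l<d w)

shortest⇒Visible : (w : Walk G x y l) → (∀ {l′} → Walk G x y l′ → l ≤ l′) → l ≤ k → AvoidsInternal S w →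
                   Visible G S k x y
shortest⇒Visible w shortest l≤k av = _ , w , (w , λ l′ l′<l w′ → <⇒≱ l′<l (shortest w′)) , l≤k , av

edge⇒Visible : x ≢ y → G x y → 1 ≤ k → Visible G S k x y
edge⇒Visible x≢y e 1≤k = shortest⇒Visible (e ∷ [] _) nonempty 1≤k tt
  where
  nonempty : ∀ {l′} → Walk _ _ _ l′ → 1 ≤ l′
  nonempty ([] _) = contradiction refl x≢y
  nonempty (_ ∷ _) = s≤s z≤n

ascending-walk : (∀ {x v} → toℕ v ≡ suc (toℕ x) → G x v) → (S : Subset n) (d : ℕ) → toℕ x + d ≡ toℕ y →
                 (∀ {t} → toℕ x < toℕ t → toℕ t < toℕ y → t ∉ S) → Σ (Walk G x y d) (AvoidsInternal S)
ascending-walk succ S zero x+0≡y _ with toℕ-injective (trans (sym (+-identityʳ _)) x+0≡y)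
... | refl = [] _ , tt
ascending-walk {n} {x = x} {y} succ S (suc d) x+1+d≡y free =
  succ x⁺≡1+x ∷ proj₁ rest , avoids-∷ _ (proj₁ rest) x⁺∉S (proj₂ rest)
  where
  1+x+d≡y : suc (toℕ x) + d ≡ toℕ y
  1+x+d≡y = trans (sym (+-suc (toℕ x) d)) x+1+d≡y
  x⁺ : Fin n
  x⁺ = fromℕ< (≤-<-trans (m≤m+n _ d) (subst (_< n) (sym 1+x+d≡y) (toℕ<n y)))
  x⁺≡1+x : toℕ x⁺ ≡ suc (toℕ x)
  x⁺≡1+x = toℕ-fromℕ< _
  x⁺+d≡y : toℕ x⁺ + d ≡ toℕ y
  x⁺+d≡y = trans (cong (_+ d) x⁺≡1+x) 1+x+d≡y
  x<x⁺ : toℕ x < toℕ x⁺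
  x<x⁺ = ≤-reflexive (sym x⁺≡1+x)
  rest : Σ (Walk _ x⁺ y d) (AvoidsInternal S)
  rest = ascending-walk succ S d x⁺+d≡y (λ x⁺<t → free (<-trans x<x⁺ x⁺<t))
  x⁺∉S : d ≢ 0 → x⁺ ∉ S
  x⁺∉S d≢0 = free x<x⁺ (subst (toℕ x⁺ <_) x⁺+d≡y (m<m+n (toℕ x⁺) (n≢0⇒n>0 d≢0)))

-- Walls lie in S, so a walk avoiding S internally can reach a wall only at its endpoint.
module _ (S : Subset n) {Inside Wall : Fin n → Set} (φ : Fin n → ℕ) (walls⊆S : ∀ {v} → Wall v → v ∈ S)
         (step : ∀ {x v} → G x v → Inside x → Wall v ⊎ (Inside v × φ v ≤ suc (φ x))) where

  private
    step-through : v ∉ S → Wall v ⊎ (Inside v × φ v ≤ suc (φ x)) → (Inside v → Inside y × φ y ≤ l + φ v) →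
                   Inside y × φ y ≤ suc l + φ x
    step-through v∉S (inj₁ wall-v) _ = contradiction (walls⊆S wall-v) v∉S
    step-through {x = x} {l = l} _ (inj₂ (in-v , φv≤)) rest with rest in-v
    ... | in-y , φy≤ = in-y , ≤-trans φy≤ (≤-trans (+-monoʳ-≤ l φv≤) (≤-reflexive (+-suc l (φ x))))

  avoiding-walk-potential : (w : Walk G x y l) → AvoidsInternal S w → Inside x → ¬ Wall y →
                            Inside y × φ y ≤ l + φ x
  avoiding-walk-potential ([] _) _ in-x _ = in-x , ≤-refl
  avoiding-walk-potential (e ∷ [] _) _ in-x ¬wall-y with step e in-x
  ... | inj₁ wall-y = contradiction wall-y ¬wall-y
  ... | inj₂ bound = bound
  avoiding-walk-potential (e ∷ (e′ ∷ w)) (v∉S , av) in-x ¬wall-y =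
    step-through v∉S (step e in-x) (λ in-v → avoiding-walk-potential (e′ ∷ w) av in-v ¬wall-y)

avoiding-walk-confined : {Inside Wall : Fin n → Set} (S : Subset n) → (∀ {v} → Wall v → v ∈ S) →
                         (∀ {x v} → G x v → Inside x → Wall v ⊎ Inside v) →
                         (w : Walk G x y l) → AvoidsInternal S w → Inside x → ¬ Wall y → Inside y
avoiding-walk-confined S walls⊆S step w av in-x ¬wall-y =
  proj₁ (avoiding-walk-potential S (λ _ → 0) walls⊆S (λ e → Sum.map₂ (_, z≤n) ∘ step e) w av in-x ¬wall-y)

data Ascending (S : Subset n) : ℕ → ℕ → Set where
  [] : ∀ {b} → Ascending S b 0
  cons : ∀ {b m} (x : Fin n) → x ∈ S → b ≤ toℕ x → Ascending S (suc (toℕ x)) m → Ascending S b (suc m)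

private
  shift : ∀ {s b m} → Ascending S b m → Ascending (s ∷ S) (suc b) m
  shift [] = []
  shift (cons x x∈S b≤x xs) = cons (Fin.suc x) (there x∈S) (s≤s b≤x) (shift xs)

  lower : ∀ {b b′ m} → b′ ≤ b → Ascending S b m → Ascending S b′ m
  lower _ [] = []
  lower b′≤b (cons x x∈S b≤x xs) = cons x x∈S (≤-trans b′≤b b≤x) xs

m≤∣S∣⇒Ascending : (S : Subset n) (m : ℕ) → m ≤ ∣ S ∣ → Ascending S 0 m
m≤∣S∣⇒Ascending S zero _ = []
m≤∣S∣⇒Ascending (inside ∷ S) (suc m) (s≤s m≤∣S∣) =
  cons Fin.zero here z≤n (shift (m≤∣S∣⇒Ascending S m m≤∣S∣))
m≤∣S∣⇒Ascending (outside ∷ S) (suc m) m<∣S∣ =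
  lower z≤n (shift (m≤∣S∣⇒Ascending S (suc m) m<∣S∣))

¬Ascending⇒∣S∣≤ : (m : ℕ) → ¬ Ascending S 0 (suc m) → ∣ S ∣ ≤ m
¬Ascending⇒∣S∣≤ {S = S} m ¬asc = ≮⇒≥ (¬asc ∘ m≤∣S∣⇒Ascending S (suc m))

pair : Subset (suc (suc n))
pair = inside ∷ inside ∷ ⊥

∣pair∣≡2 : ∣ pair {n} ∣ ≡ 2
∣pair∣≡2 {n} = cong (suc ∘ suc) (∣⊥∣≡0 n)

pair-visible : {G : Graph (suc (suc n))} → Symmetric G → G Fin.zero (Fin.suc Fin.zero) → 1 ≤ k →
               IsKDistMutVis G k pair
pair-visible G-sym e 1≤k _ _ here here 0≢0 = contradiction refl 0≢0
pair-visible G-sym e 1≤k _ _ here (there here) 0≢1 = edge⇒Visible 0≢1 e 1≤k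
pair-visible G-sym e 1≤k _ _ (there here) here 1≢0 = edge⇒Visible 1≢0 (G-sym e) 1≤k
pair-visible G-sym e 1≤k _ _ (there here) (there here) 1≢1 = contradiction refl 1≢1
pair-visible G-sym e 1≤k _ _ (there (there x∈⊥)) _ _ = contradiction x∈⊥ ∉⊥
pair-visible G-sym e 1≤k _ _ _ (there (there y∈⊥)) _ = contradiction y∈⊥ ∉⊥

∈-triple : ∀ {a b c t : Fin n} → t ∈ ⁅ a ⁆ ∪ ⁅ b ⁆ ∪ ⁅ c ⁆ → t ≡ a ⊎ t ≡ b ⊎ t ≡ c
∈-triple {a = a} {b} {c} t∈ =
  Sum.map (x∈⁅y⁆⇒x≡y a) (Sum.map (x∈⁅y⁆⇒x≡y b) (x∈⁅y⁆⇒x≡y c) ∘ x∈p∪q⁻ _ _) (x∈p∪q⁻ _ _ t∈)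

a∈triple : ∀ (a b c : Fin n) → a ∈ ⁅ a ⁆ ∪ ⁅ b ⁆ ∪ ⁅ c ⁆
a∈triple a b c = x∈p∪q⁺ (inj₁ (x∈⁅x⁆ a))

b∈triple : ∀ (a b c : Fin n) → b ∈ ⁅ a ⁆ ∪ ⁅ b ⁆ ∪ ⁅ c ⁆
b∈triple a b c = x∈p∪q⁺ (inj₂ (x∈p∪q⁺ (inj₁ (x∈⁅x⁆ b))))

c∈triple : ∀ (a b c : Fin n) → c ∈ ⁅ a ⁆ ∪ ⁅ b ⁆ ∪ ⁅ c ⁆
c∈triple a b c = x∈p∪q⁺ (inj₂ (x∈p∪q⁺ (inj₂ (x∈⁅x⁆ c))))

3≤∣triple∣ : ∀ {a b c : Fin n} → a ≢ b → a ≢ c → b ≢ c → 3 ≤ ∣ ⁅ a ⁆ ∪ ⁅ b ⁆ ∪ ⁅ c ⁆ ∣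
3≤∣triple∣ {a = a} {b} {c} a≢b a≢c b≢c =
  ≤-trans (s≤s (≤-trans (s≤s (≤-trans (s≤s z≤n) (x∈p⇒∣p-x∣<∣p∣ c∈))) (x∈p⇒∣p-x∣<∣p∣ b∈)))
          (x∈p⇒∣p-x∣<∣p∣ a∈)
  where
  a∈ : a ∈ ⁅ a ⁆ ∪ ⁅ b ⁆ ∪ ⁅ c ⁆
  a∈ = a∈triple a b c
  b∈ : b ∈ (⁅ a ⁆ ∪ ⁅ b ⁆ ∪ ⁅ c ⁆) ∖ a
  b∈ = x∈p∧x≢y⇒x∈p-y (b∈triple a b c) (a≢b ∘ sym)
  c∈ : c ∈ (⁅ a ⁆ ∪ ⁅ b ⁆ ∪ ⁅ c ⁆) ∖ a ∖ b
  c∈ = x∈p∧x≢y⇒x∈p-y (x∈p∧x≢y⇒x∈p-y (c∈triple a b c) (a≢c ∘ sym)) (b≢c ∘ sym)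

triple-visible : ∀ {a b c} → Symmetric G → let T = ⁅ a ⁆ ∪ ⁅ b ⁆ ∪ ⁅ c ⁆ in
                 Visible G T k a b → Visible G T k b c → Visible G T k c a → IsKDistMutVis G k T
triple-visible {G = G} {k = k} {a} {b} {c} G-sym ab bc ca x y x∈ y∈ x≢y =
  go (∈-triple x∈) (∈-triple y∈)
  where
  go : x ≡ a ⊎ x ≡ b ⊎ x ≡ c → y ≡ a ⊎ y ≡ b ⊎ y ≡ c → Visible G (⁅ a ⁆ ∪ ⁅ b ⁆ ∪ ⁅ c ⁆) k x y
  go (inj₁ refl) (inj₁ refl) = contradiction refl x≢y
  go (inj₁ refl) (inj₂ (inj₁ refl)) = ab
  go (inj₁ refl) (inj₂ (inj₂ refl)) = Visible-sym G-sym ca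
  go (inj₂ (inj₁ refl)) (inj₁ refl) = Visible-sym G-sym ab
  go (inj₂ (inj₁ refl)) (inj₂ (inj₁ refl)) = contradiction refl x≢y
  go (inj₂ (inj₁ refl)) (inj₂ (inj₂ refl)) = bc
  go (inj₂ (inj₂ refl)) (inj₁ refl) = ca
  go (inj₂ (inj₂ refl)) (inj₂ (inj₁ refl)) = Visible-sym G-sym bc
  go (inj₂ (inj₂ refl)) (inj₂ (inj₂ refl)) = contradiction refl x≢y

IsMuK-intro : ∀ {μ} → IsKDistMutVis G k S → μ ≤ ∣ S ∣ → (∀ S′ → IsKDistMutVis G k S′ → ∣ S′ ∣ ≤ μ) →
              IsMuK G k μ
IsMuK-intro {S = S} vis μ≤∣S∣ maximal = (S , vis , ≤-antisym (maximal S vis) μ≤∣S∣) , maximal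

IsMuK-pair : {G : Graph (suc (suc n))} → Symmetric G → G Fin.zero (Fin.suc Fin.zero) → 1 ≤ k →
             (∀ S → IsKDistMutVis G k S → ∣ S ∣ ≤ 2) → IsMuK G k 2
IsMuK-pair {n} G-sym e 1≤k = IsMuK-intro (pair-visible G-sym e 1≤k) (≤-reflexive (sym (∣pair∣≡2 {n})))

at-or-below : toℕ v ≤ toℕ x → v ≡ x ⊎ toℕ v < toℕ x
at-or-below v≤x = Sum.swap (Sum.map₂ toℕ-injective (m≤n⇒m<n∨m≡n v≤x))

at-or-above : toℕ x ≤ toℕ v → v ≡ x ⊎ toℕ x < toℕ v
at-or-above x≤v = Sum.swap (Sum.map₂ (sym ∘ toℕ-injective) (m≤n⇒m<n∨m≡n x≤v))

PathG-sym : Symmetric (PathG n)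
PathG-sym = Sum.swap

PathG-ascent : PathG n x v → toℕ v ≤ suc (toℕ x)
PathG-ascent (inj₁ v≡1+x) = ≤-reflexive v≡1+x
PathG-ascent (inj₂ x≡1+v) = ≤-trans (n≤1+n _) (≤-trans (≤-reflexive (sym x≡1+v)) (n≤1+n _))

path-blocked : ∀ {a b c} → toℕ a < toℕ b → toℕ b < toℕ c → b ∈ S → ¬ Visible (PathG n) S k a c
path-blocked {n} {S = S} {b = b} a<b b<c b∈S (_ , w , _ , _ , av) =
  <-asym b<c (avoiding-walk-confined S (λ { refl → b∈S }) step w av a<b (λ { refl → <-irrefl refl b<c }))
  where
  step : PathG n x v → toℕ x < toℕ b → v ≡ b ⊎ toℕ v < toℕ b
  step e x<b = at-or-below (≤-trans (PathG-ascent e) x<b)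

path-∣S∣≤2 : ∀ S → IsKDistMutVis (PathG n) k S → ∣ S ∣ ≤ 2
path-∣S∣≤2 S vis = ¬Ascending⇒∣S∣≤ 2 no-triple
  where
  no-triple : ¬ Ascending S 0 3
  no-triple (cons a a∈S _ (cons b b∈S a<b (cons c c∈S b<c []))) =
    path-blocked a<b b<c b∈S (vis a c a∈S c∈S (<⇒≢ᶠ (<-trans a<b b<c)))

∣n-1+n∣≡1 : ∀ n → ∣ n - suc n ∣ ≡ 1
∣n-1+n∣≡1 n = trans (cong (∣ n -_∣) (+-comm 1 n)) (∣m-m+n∣≡n n 1)

∣m+n-m∣≡n : ∀ m n → ∣ m + n - m ∣ ≡ n
∣m+n-m∣≡n m n = trans (∣-∣-comm (m + n) m) (∣m-m+n∣≡n m n)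

-- ArcWithin N l i j : one of the two arcs between positions i and j of a cycle of length N,
-- of lengths ∣ i - j ∣ (avoiding the edge between N ∸ 1 and 0) and N ∸ ∣ i - j ∣, has length at most l.
data ArcWithin (N l i j : ℕ) : Set where
  direct : ∣ i - j ∣ ≤ l → ArcWithin N l i j
  wrapping : N ≤ ∣ i - j ∣ + l → ArcWithin N l i j

ArcWithin-refl : ∀ {N} i → ArcWithin N 0 i i
ArcWithin-refl i = direct (≤-reflexive (∣n-n∣≡0 i))

ArcWithin-step : ∀ {N l i v j} → ∣ i - v ∣ ≡ 1 → ArcWithin N l v j → ArcWithin N (suc l) i j
ArcWithin-step {l = l} {i} {v} {j} ∣i-v∣≡1 (direct v-j≤l) =
  direct (≤-trans (∣-∣-triangle i v j) (≤-trans (≤-reflexive (cong (_+ ∣ v - j ∣) ∣i-v∣≡1)) (s≤s v-j≤l)))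
ArcWithin-step {l = l} {i} {v} {j} ∣i-v∣≡1 (wrapping N≤v-j+l) =
  wrapping (≤-trans N≤v-j+l (≤-trans (+-monoˡ-≤ l v-j≤) (≤-reflexive (sym (+-suc ∣ i - j ∣ l)))))
  where
  v-j≤ : ∣ v - j ∣ ≤ suc ∣ i - j ∣
  v-j≤ = ≤-trans (∣-∣-triangle v i j) (≤-reflexive (cong (_+ ∣ i - j ∣) (trans (∣-∣-comm v i) ∣i-v∣≡1)))

ArcWithin-wrap : ∀ {m l j e} → j + e ≡ m → ArcWithin (suc m) l m j → ArcWithin (suc m) (suc l) 0 j
ArcWithin-wrap {l = l} {j} {e} refl (direct e≤l) =
  wrapping (≤-trans (s≤s (+-monoʳ-≤ j (subst (_≤ l) (∣m+n-m∣≡n j e) e≤l))) (≤-reflexive (sym (+-suc j l))))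
ArcWithin-wrap {l = l} {j} {e} refl (wrapping N≤e+l) =
  direct (≤-trans (n≤1+n j) (≤-trans (+-cancelʳ-≤ e (suc j) l N≤l+e) (n≤1+n l)))
  where
  N≤l+e : suc j + e ≤ l + e
  N≤l+e = ≤-trans N≤e+l (≤-reflexive (trans (cong (_+ l) (∣m+n-m∣≡n j e)) (+-comm e l)))

ArcWithin-unwrap : ∀ {m l j e} → j + e ≡ m → ArcWithin (suc m) l 0 j → ArcWithin (suc m) (suc l) m j
ArcWithin-unwrap {l = l} {j} {e} refl (direct j≤l) =
  wrapping (≤-trans (s≤s (≤-trans (≤-reflexive (+-comm j e)) (+-monoʳ-≤ e j≤l))) (≤-reflexive (sym e+1+l≡)))
  where
  e+1+l≡ : ∣ j + e - j ∣ + suc l ≡ suc (e + l)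
  e+1+l≡ = trans (cong (_+ suc l) (∣m+n-m∣≡n j e)) (+-suc e l)
ArcWithin-unwrap {l = l} {j} {e} refl (wrapping N≤j+l) =
  direct (subst (_≤ suc l) (sym (∣m+n-m∣≡n j e)) (≤-trans (n≤1+n e) (≤-trans 1+e≤l (n≤1+n l))))
  where
  1+e≤l : suc e ≤ l
  1+e≤l = +-cancelˡ-≤ j (suc e) l (≤-trans (≤-reflexive (+-suc j e)) N≤j+l)

ArcWithin⇒≤ : ∀ {N l i j s} → ArcWithin N l i j → ∣ i - j ∣ ≡ s ⊎ ∣ i - j ∣ + s ≡ N → s + s ≤ N → s ≤ l
ArcWithin⇒≤ (direct d≤l) (inj₁ refl) _ = d≤l
ArcWithin⇒≤ {i = i} {j} (direct d≤l) (inj₂ refl) 2s≤N = ≤-trans (+-cancelʳ-≤ _ _ ∣ i - j ∣ 2s≤N) d≤l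
ArcWithin⇒≤ {i = i} {j} (wrapping N≤d+l) (inj₁ refl) 2s≤N = +-cancelˡ-≤ ∣ i - j ∣ _ _ (≤-trans 2s≤N N≤d+l)
ArcWithin⇒≤ {i = i} {j} (wrapping N≤d+l) (inj₂ refl) _ = +-cancelˡ-≤ ∣ i - j ∣ _ _ N≤d+l

perimeter : ∀ {N a b c l₁ l₂ l₃} → b + N ≤ l₁ + (a + N) → c ≤ l₂ + b → a + N ≤ l₃ + c → N ≤ l₃ + (l₂ + l₁)
perimeter {N} {a} {b} {c} {l₁} {l₂} {l₃} ab bc ca = +-cancelʳ-≤ a N (l₃ + (l₂ + l₁)) (begin
  N + a                ≡⟨ +-comm N a ⟩
  a + N                ≤⟨ ca ⟩
  l₃ + c               ≤⟨ +-monoʳ-≤ l₃ bc ⟩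
  l₃ + (l₂ + b)        ≤⟨ +-monoʳ-≤ l₃ (+-monoʳ-≤ l₂ b≤l₁+a) ⟩
  l₃ + (l₂ + (l₁ + a)) ≡⟨ cong (l₃ +_) (sym (+-assoc l₂ l₁ a)) ⟩
  l₃ + (l₂ + l₁ + a)   ≡⟨ sym (+-assoc l₃ (l₂ + l₁) a) ⟩
  l₃ + (l₂ + l₁) + a   ∎)
  where
  open ≤-Reasoning
  b≤l₁+a : b ≤ l₁ + a
  b≤l₁+a = +-cancelʳ-≤ N b (l₁ + a) (≤-trans ab (≤-reflexive (sym (+-assoc l₁ a N))))

arcs-sum : ∀ {i j M} → i ≤ j → j ≤ M → (j ∸ i) + ((M ∸ j) + suc i) ≡ suc M
arcs-sum {i} {j} {M} i≤j j≤M = begin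
  (j ∸ i) + ((M ∸ j) + suc i) ≡⟨ x∙yz≈y∙xz (j ∸ i) (M ∸ j) (suc i) ⟩
  (M ∸ j) + ((j ∸ i) + suc i) ≡⟨ cong ((M ∸ j) +_) (+-suc (j ∸ i) i) ⟩
  (M ∸ j) + suc ((j ∸ i) + i) ≡⟨ cong (λ t → (M ∸ j) + suc t) (m∸n+n≡m i≤j) ⟩
  (M ∸ j) + suc j             ≡⟨ +-suc (M ∸ j) j ⟩
  suc ((M ∸ j) + j)           ≡⟨ cong suc (m∸n+n≡m j≤M) ⟩
  suc M                       ∎
  where
  open ≡-Reasoning

split-off : ∀ {k L U N} → 0 < k → L ≤ U → L < N → N ≤ k + U →
            ∃ λ p → ∃ λ M → (0 < p × p ≤ k) × (L ≤ M × M ≤ U) × p + M ≡ N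
split-off {k} {L} {U} {suc N′} 0<k L≤U (s≤s L≤N′) N≤k+U with N′ ≤? U
... | yes N′≤U = 1 , N′ , (s≤s z≤n , 0<k) , (L≤N′ , N′≤U) , refl
... | no N′≰U = suc N′ ∸ U , U , (m<n⇒0<n∸m U<N , N∸U≤k) , (L≤U , ≤-refl) , m∸n+n≡m (<⇒≤ U<N)
  where
  U<N : U < suc N′
  U<N = m<n⇒m<1+n (≰⇒> N′≰U)
  N∸U≤k : suc N′ ∸ U ≤ k
  N∸U≤k = ≤-trans (∸-monoˡ-≤ U N≤k+U) (≤-reflexive (m+n∸n≡m k U))

split-in-three : ∀ {k N} → 0 < k → 3 ≤ N → N ≤ 3 * k →
                 ∃ λ p → ∃ λ q → ∃ λ r → (0 < p × p ≤ k) × (0 < q × q ≤ k) × (0 < r × r ≤ k) × p + q + r ≡ N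
split-in-three {k} {N} 0<k 3≤N N≤3k with split-off 0<k (+-mono-≤ 0<k 0<k) 3≤N N≤k+2k
  where
  N≤k+2k : N ≤ k + (k + k)
  N≤k+2k = subst (N ≤_) (cong (λ t → k + (k + t)) (+-identityʳ k)) N≤3k
... | p , M , p∈[1,k] , (2≤M , M≤2k) , p+M≡N with split-off 0<k 0<k 2≤M M≤2k
... | q , r , q∈[1,k] , r∈[1,k] , q+r≡M =
  p , q , r , p∈[1,k] , q∈[1,k] , r∈[1,k] , trans (+-assoc p q r) (trans (cong (p +_) q+r≡M) p+M≡N)

module Cycle (m : ℕ) where

  N : ℕ
  N = suc m

  C : Graph N
  C = CycleG N

  last : Fin N
  last = fromℕ m

  wrap : C last Fin.zero
  wrap = inj₂ (inj₂ (refl , toℕ-fromℕ m))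

  successor-edge : toℕ v ≡ suc (toℕ x) → C x v
  successor-edge = inj₁ ∘ inj₁

  CycleG-sym : Symmetric C
  CycleG-sym (inj₁ e) = inj₁ (Sum.swap e)
  CycleG-sym (inj₂ e) = inj₂ (Sum.swap e)

  CycleG-ascent : C x v → toℕ v ≤ suc (toℕ x) ⊎ (toℕ x ≡ 0 × toℕ v ≡ m)
  CycleG-ascent (inj₁ e) = inj₁ (PathG-ascent e)
  CycleG-ascent (inj₂ (inj₁ x≡0∧v≡m)) = inj₂ x≡0∧v≡m
  CycleG-ascent (inj₂ (inj₂ (v≡0 , _))) = inj₁ (≤-trans (≤-reflexive v≡0) z≤n)

  walk⇒ArcWithin : Walk C x y l → ArcWithin N l (toℕ x) (toℕ y)
  walk⇒ArcWithin ([] x) = ArcWithin-refl (toℕ x)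
  walk⇒ArcWithin {y = y} (e ∷ w) = edge-step e (walk⇒ArcWithin w)
    where
    y+[m∸y]≡m : toℕ y + (m ∸ toℕ y) ≡ m
    y+[m∸y]≡m = m+[n∸m]≡n (≤-pred (toℕ<n y))
    edge-step : C x v → ArcWithin N l (toℕ v) (toℕ y) → ArcWithin N (suc l) (toℕ x) (toℕ y)
    edge-step {x} (inj₁ (inj₁ v≡1+x)) =
      ArcWithin-step (trans (cong (∣ toℕ x -_∣) v≡1+x) (∣n-1+n∣≡1 (toℕ x)))
    edge-step {v = v} (inj₁ (inj₂ x≡1+v)) =
      ArcWithin-step (trans (cong (∣_- toℕ v ∣) x≡1+v)
                            (trans (∣-∣-comm (suc (toℕ v)) (toℕ v)) (∣n-1+n∣≡1 (toℕ v))))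
    edge-step (inj₂ (inj₁ (x≡0 , v≡m))) rewrite x≡0 | v≡m = ArcWithin-wrap y+[m∸y]≡m
    edge-step (inj₂ (inj₂ (v≡0 , x≡m))) rewrite x≡m | v≡0 = ArcWithin-unwrap y+[m∸y]≡m

  arc-visible : ∀ {s} (w : Walk C x y s) → AvoidsInternal S w → s ≤ k → s + s ≤ N →
                ∣ toℕ x - toℕ y ∣ ≡ s ⊎ ∣ toℕ x - toℕ y ∣ + s ≡ N → Visible C S k x y
  arc-visible w av s≤k 2s≤N arc =
    shortest⇒Visible w (λ w′ → ArcWithin⇒≤ (walk⇒ArcWithin w′) arc 2s≤N) s≤k av

  -- Position of v on the cycle cut open just before z: z, …, m keep their positions and
  -- 0, …, z ∸ 1 are moved behind m.
  cut : Fin N → Fin N → ℕ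
  cut z v with toℕ v <? toℕ z
  ... | yes _ = toℕ v + N
  ... | no _ = toℕ v

  cut-< : toℕ v < toℕ z → cut z v ≡ toℕ v + N
  cut-< {v} {z} v<z with toℕ v <? toℕ z
  ... | yes _ = refl
  ... | no v≮z = contradiction v<z v≮z

  cut-≥ : toℕ z ≤ toℕ v → cut z v ≡ toℕ v
  cut-≥ {z} {v} z≤v with toℕ v <? toℕ z
  ... | yes v<z = contradiction z≤v (<⇒≱ v<z)
  ... | no _ = refl

  cut-step : C x v → x ≢ z → cut z v ≤ suc (cut z x)
  cut-step {x} {v} {z} e x≢z with toℕ v <? toℕ z | toℕ x <? toℕ z
  ... | yes v<z | yes _ with CycleG-ascent e
  ...   | inj₁ v≤1+x = +-monoˡ-≤ N v≤1+x
  ...   | inj₂ (_ , v≡m) = contradiction (subst (toℕ z ≤_) (sym v≡m) (≤-pred (toℕ<n z))) (<⇒≱ v<z)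
  cut-step {x} {v} {z} e x≢z | no _ | no x≮z with CycleG-ascent e
  ...   | inj₁ v≤1+x = v≤1+x
  ...   | inj₂ (x≡0 , _) =
    contradiction (toℕ-injective (trans x≡0 (sym (n≤0⇒n≡0 (subst (toℕ z ≤_) x≡0 (≮⇒≥ x≮z)))))) x≢z
  cut-step {x} {v} {z} e x≢z | yes v<z | no x≮z with CycleG-ascent (CycleG-sym e)
  ...   | inj₁ x≤1+v = contradiction (toℕ-injective (≤-antisym (≤-trans x≤1+v v<z) (≮⇒≥ x≮z))) x≢z
  ...   | inj₂ (v≡0 , x≡m) = ≤-reflexive (trans (cong (_+ N) v≡0) (cong suc (sym x≡m)))
  cut-step {x} {v} e _ | no _ | yes _ = ≤-trans (<⇒≤ (toℕ<n v)) (≤-trans (m≤n+m N (toℕ x)) (n≤1+n _))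

  cut-walk : z ∈ S → (w : Walk C x y l) → AvoidsInternal S w → x ≢ z → y ≢ z → cut z y ≤ l + cut z x
  cut-walk {z = z} {S} z∈S w av x≢z y≢z =
    proj₂ (avoiding-walk-potential S (cut z) (λ { refl → z∈S }) step w av x≢z y≢z)
    where
    step : C x v → x ≢ z → v ≡ z ⊎ (v ≢ z × cut z v ≤ suc (cut z x))
    step {v = v} e x≢z with v ≟ᶠ z
    ... | yes v≡z = inj₁ v≡z
    ... | no v≢z = inj₂ (v≢z , cut-step e x≢z)

  visible-triangle⇒N≤3k : ∀ {a b c} → toℕ a < toℕ b → toℕ b < toℕ c → a ∈ S → b ∈ S → c ∈ S →
                          Visible C S k a b → Visible C S k b c → Visible C S k c a → N ≤ 3 * k
  visible-triangle⇒N≤3k {k = k} {a} {b} {c} a<b b<c a∈S b∈S c∈S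
    (l₁ , w₁ , _ , l₁≤k , av₁) (l₂ , w₂ , _ , l₂≤k , av₂) (l₃ , w₃ , _ , l₃≤k , av₃) = begin
      N               ≤⟨ perimeter {N} {toℕ a} {toℕ b} {toℕ c} ab bc ca ⟩
      l₃ + (l₂ + l₁)  ≤⟨ +-mono-≤ l₃≤k (+-mono-≤ l₂≤k l₁≤k) ⟩
      k + (k + k)     ≡⟨ cong (λ t → k + (k + t)) (sym (+-identityʳ k)) ⟩
      3 * k           ∎
    where
    open ≤-Reasoning
    a<c : toℕ a < toℕ c
    a<c = <-trans a<b b<c
    -- Each walk avoids the third vertex, which is where the cycle is cut open.
    ab : toℕ b + N ≤ l₁ + (toℕ a + N)
    ab = subst₂ (λ s t → s ≤ l₁ + t) (cut-< b<c) (cut-< a<c)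
           (cut-walk c∈S w₁ av₁ (<⇒≢ᶠ a<c) (<⇒≢ᶠ b<c))
    bc : toℕ c ≤ l₂ + toℕ b
    bc = subst₂ (λ s t → s ≤ l₂ + t) (cut-≥ (<⇒≤ a<c)) (cut-≥ (<⇒≤ a<b))
           (cut-walk a∈S w₂ av₂ (<⇒≢ᶠ a<b ∘ sym) (<⇒≢ᶠ a<c ∘ sym))
    ca : toℕ a + N ≤ l₃ + toℕ c
    ca = subst₂ (λ s t → s ≤ l₃ + t) (cut-< a<b) (cut-≥ (<⇒≤ b<c))
           (cut-walk b∈S w₃ av₃ (<⇒≢ᶠ b<c ∘ sym) (<⇒≢ᶠ a<b))

  cycle-blocked : ∀ {a b c d} → toℕ a < toℕ b → toℕ b < toℕ c → toℕ c < toℕ d → b ∈ S → d ∈ S →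
                  ¬ Visible C S k a c
  cycle-blocked {S = S} {a = a} {b} {c} {d} a<b b<c c<d b∈S d∈S (_ , w , _ , _ , av) =
    [ <-asym b<c , <-asym c<d ]′ (avoiding-walk-confined S walls⊆S step w av (inj₁ a<b) c-not-wall)
    where
    c-not-wall : ¬ (c ≡ b ⊎ c ≡ d)
    c-not-wall (inj₁ refl) = <-irrefl refl b<c
    c-not-wall (inj₂ refl) = <-irrefl refl c<d
    walls⊆S : ∀ {v} → v ≡ b ⊎ v ≡ d → v ∈ S
    walls⊆S (inj₁ refl) = b∈S
    walls⊆S (inj₂ refl) = d∈S
    step : C x v → toℕ x < toℕ b ⊎ toℕ d < toℕ x → (v ≡ b ⊎ v ≡ d) ⊎ (toℕ v < toℕ b ⊎ toℕ d < toℕ v)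
    step e (inj₁ x<b) with CycleG-ascent e
    ... | inj₁ v≤1+x = Sum.map inj₁ inj₁ (at-or-below (≤-trans v≤1+x x<b))
    ... | inj₂ (_ , v≡m) = Sum.map inj₂ inj₂ (at-or-above (subst (toℕ d ≤_) (sym v≡m) (≤-pred (toℕ<n d))))
    step e (inj₂ d<x) with CycleG-ascent (CycleG-sym e)
    ... | inj₁ x≤1+v = Sum.map inj₂ inj₂ (at-or-above (≤-pred (≤-trans d<x x≤1+v)))
    ... | inj₂ (v≡0 , _) = inj₂ (inj₁ (subst (_< toℕ b) (sym v≡0) (≤-<-trans z≤n a<b)))

  cycle-∣S∣≤3 : ∀ S → IsKDistMutVis C k S → ∣ S ∣ ≤ 3
  cycle-∣S∣≤3 S vis = ¬Ascending⇒∣S∣≤ 3 no-quadruple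
    where
    no-quadruple : ¬ Ascending S 0 4
    no-quadruple (cons a a∈S _ (cons b b∈S a<b (cons c c∈S b<c (cons d d∈S c<d [])))) =
      cycle-blocked a<b b<c c<d b∈S d∈S (vis a c a∈S c∈S (<⇒≢ᶠ (<-trans a<b b<c)))

  cycle-∣S∣≤2 : ¬ (N ≤ 3 * k) → ∀ S → IsKDistMutVis C k S → ∣ S ∣ ≤ 2
  cycle-∣S∣≤2 N≰3k S vis = ¬Ascending⇒∣S∣≤ 2 no-triple
    where
    no-triple : ¬ Ascending S 0 3
    no-triple (cons a a∈S _ (cons b b∈S a<b (cons c c∈S b<c []))) =
      N≰3k (visible-triangle⇒N≤3k a<b b<c a∈S b∈S c∈S (vis a b a∈S b∈S (<⇒≢ᶠ a<b))
                                  (vis b c b∈S c∈S (<⇒≢ᶠ b<c)) (vis c a c∈S a∈S (<⇒≢ᶠ (<-trans a<b b<c) ∘ sym)))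

  unobstructed-walk : ∀ d → toℕ x + d ≡ toℕ y → Walk C x y d
  unobstructed-walk d x+d≡y = proj₁ (ascending-walk successor-edge ⊥ d x+d≡y (λ _ _ → ∉⊥))

  two-arcs : ∀ {D} → toℕ x ≤ toℕ y → Dist C x y D → D + D ≤ N
  two-arcs {x} {y} x≤y dist =
    ≤-trans (+-mono-≤ D≤direct D≤around) (≤-reflexive (arcs-sum x≤y (≤-pred (toℕ<n y))))
    where
    D≤direct : _ ≤ toℕ y ∸ toℕ x
    D≤direct = Dist⇒≤-length dist (unobstructed-walk _ (m+[n∸m]≡n x≤y))
    y+[m∸y]≡last : toℕ y + (m ∸ toℕ y) ≡ toℕ last
    y+[m∸y]≡last = trans (m+[n∸m]≡n (≤-pred (toℕ<n y))) (sym (toℕ-fromℕ m))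
    D≤around : _ ≤ (m ∸ toℕ y) + suc (toℕ x)
    D≤around = Dist⇒≤-length (Dist-sym CycleG-sym dist)
                 (unobstructed-walk _ y+[m∸y]≡last ++ (wrap ∷ unobstructed-walk (toℕ x) refl))

  diameter-bound : ∀ {D} → IsDiameter C D → D + D ≤ N
  diameter-bound (_ , x , y , dist) with ≤-total (toℕ x) (toℕ y)
  ... | inj₁ x≤y = two-arcs x≤y dist
  ... | inj₂ y≤x = two-arcs y≤x (Dist-sym CycleG-sym dist)

  -- Vertices at positions p, p + q and m, cutting the cycle into arcs of lengths q, r and 1 + p.
  module Triangle {k p q r : ℕ} (p+q+r≡m : p + q + r ≡ m) (0<q : 0 < q) (0<r : 0 < r)
                  (1+p≤k : suc p ≤ k) (q≤k : q ≤ k) (r≤k : r ≤ k) (2k≤N : k + k ≤ N) where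

    p<p+q : p < p + q
    p<p+q = m<m+n p 0<q

    p+q<m : p + q < m
    p+q<m = subst (p + q <_) p+q+r≡m (m<m+n (p + q) 0<r)

    u : Fin N
    u = fromℕ< (<-trans p<p+q (<-trans p+q<m (n<1+n m)))

    w : Fin N
    w = fromℕ< (<-trans p+q<m (n<1+n m))

    u≡p : toℕ u ≡ p
    u≡p = toℕ-fromℕ< _

    w≡p+q : toℕ w ≡ p + q
    w≡p+q = toℕ-fromℕ< _

    last≡m : toℕ last ≡ m
    last≡m = toℕ-fromℕ m

    T : Subset N
    T = ⁅ u ⁆ ∪ ⁅ w ⁆ ∪ ⁅ last ⁆

    ∉T : ∀ {t} → toℕ t ≢ p → toℕ t ≢ p + q → toℕ t ≢ m → t ∉ T
    ∉T t≢p t≢p+q t≢m t∈T with ∈-triple t∈T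
    ... | inj₁ refl = t≢p u≡p
    ... | inj₂ (inj₁ refl) = t≢p+q w≡p+q
    ... | inj₂ (inj₂ refl) = t≢m last≡m

    before-u∉T : ∀ {t} → toℕ t < p → t ∉ T
    before-u∉T t<p = ∉T (<⇒≢ t<p) (<⇒≢ (<-trans t<p p<p+q)) (<⇒≢ (<-trans t<p (<-trans p<p+q p+q<m)))

    between-u-w∉T : ∀ {t} → toℕ u < toℕ t → toℕ t < toℕ w → t ∉ T
    between-u-w∉T u<t t<w = ∉T (>⇒≢ p<t) (<⇒≢ t<p+q) (<⇒≢ (<-trans t<p+q p+q<m))
      where
      p<t : p < _
      p<t = subst (_< _) u≡p u<t
      t<p+q : _ < p + q
      t<p+q = subst (_ <_) w≡p+q t<w

    between-w-last∉T : ∀ {t} → toℕ w < toℕ t → toℕ t < toℕ last → t ∉ T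
    between-w-last∉T {t} w<t t<last =
      ∉T (>⇒≢ (<-trans p<p+q p+q<t)) (>⇒≢ p+q<t) (<⇒≢ (subst (toℕ t <_) last≡m t<last))
      where
      p+q<t : p + q < _
      p+q<t = subst (_< _) w≡p+q w<t

    short : ∀ {s} → s ≤ k → s + s ≤ N
    short s≤k = ≤-trans (+-mono-≤ s≤k s≤k) 2k≤N

    u-sees-w : Visible C T k u w
    u-sees-w = arc-visible (proj₁ arc) (proj₂ arc) q≤k (short q≤k) (inj₁ ∣u-w∣≡q)
      where
      arc : Σ (Walk C u w q) (AvoidsInternal T)
      arc = ascending-walk successor-edge T q (trans (cong (_+ q) u≡p) (sym w≡p+q)) between-u-w∉T
      ∣u-w∣≡q : ∣ toℕ u - toℕ w ∣ ≡ q
      ∣u-w∣≡q = trans (cong₂ ∣_-_∣ u≡p w≡p+q) (∣m-m+n∣≡n p q)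

    w-sees-last : Visible C T k w last
    w-sees-last = arc-visible (proj₁ arc) (proj₂ arc) r≤k (short r≤k) (inj₁ ∣w-last∣≡r)
      where
      w+r≡last : toℕ w + r ≡ toℕ last
      w+r≡last = trans (cong (_+ r) w≡p+q) (trans p+q+r≡m (sym last≡m))
      arc : Σ (Walk C w last r) (AvoidsInternal T)
      arc = ascending-walk successor-edge T r w+r≡last between-w-last∉T
      ∣w-last∣≡r : ∣ toℕ w - toℕ last ∣ ≡ r
      ∣w-last∣≡r = trans (cong (∣ toℕ w -_∣) (sym w+r≡last)) (∣m-m+n∣≡n (toℕ w) r)

    last-sees-u : Visible C T k last u
    last-sees-u = arc-visible (wrap ∷ proj₁ arc) (avoids-∷ wrap (proj₁ arc) 0∉T (proj₂ arc))
                              1+p≤k (short 1+p≤k) (inj₂ ∣last-u∣+1+p≡N)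
      where
      arc : Σ (Walk C Fin.zero u p) (AvoidsInternal T)
      arc = ascending-walk successor-edge T p (sym u≡p) (λ _ t<u → before-u∉T (subst (_ <_) u≡p t<u))
      0∉T : p ≢ 0 → Fin.zero ∉ T
      0∉T p≢0 = before-u∉T (n≢0⇒n>0 p≢0)
      p≤m : p ≤ m
      p≤m = <⇒≤ (<-trans p<p+q p+q<m)
      ∣last-u∣+1+p≡N : ∣ toℕ last - toℕ u ∣ + suc p ≡ N
      ∣last-u∣+1+p≡N = begin
        ∣ toℕ last - toℕ u ∣ + suc p ≡⟨ cong (_+ suc p) (trans (cong₂ ∣_-_∣ last≡m u≡p) (m≤n⇒∣n-m∣≡n∸m p≤m)) ⟩
        (m ∸ p) + suc p             ≡⟨ +-suc (m ∸ p) p ⟩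
        suc ((m ∸ p) + p)           ≡⟨ cong suc (m∸n+n≡m p≤m) ⟩
        N                           ∎
        where
        open ≡-Reasoning

    triangle : Σ (Subset N) λ S → IsKDistMutVis C k S × 3 ≤ ∣ S ∣
    triangle =
      T , triple-visible CycleG-sym u-sees-w w-sees-last last-sees-u , 3≤∣triple∣ u≢w u≢last w≢last
      where
      u≢w : u ≢ w
      u≢w = <⇒≢ᶠ (subst₂ _<_ (sym u≡p) (sym w≡p+q) p<p+q)
      u≢last : u ≢ last
      u≢last = <⇒≢ᶠ (subst₂ _<_ (sym u≡p) (sym last≡m) (<-trans p<p+q p+q<m))
      w≢last : w ≢ last
      w≢last = <⇒≢ᶠ (subst₂ _<_ (sym w≡p+q) (sym last≡m) p+q<m)

  mutually-visible-triple : 1 ≤ k → 3 ≤ N → N ≤ 3 * k → k + k ≤ N →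
                            Σ (Subset N) λ S → IsKDistMutVis C k S × 3 ≤ ∣ S ∣
  mutually-visible-triple 1≤k 3≤N N≤3k 2k≤N with split-in-three 1≤k 3≤N N≤3k
  ... | suc p , q , r , (s≤s z≤n , 1+p≤k) , (0<q , q≤k) , (0<r , r≤k) , 1+p+q+r≡N =
    Triangle.triangle (suc-injective 1+p+q+r≡N) 0<q 0<r 1+p≤k q≤k r≤k 2k≤N

proposition4p1 : (k n : ℕ) → 1 ≤ k → 3 ≤ n →
    (∀ D → IsDiameter (PathG n) D → k ≤ D → IsMuK (PathG n) k 2)
    × (∀ D → IsDiameter (CycleG n) D → k ≤ D →
         (n ≤ 3 * k → IsMuK (CycleG n) k 3) × (¬ (n ≤ 3 * k) → IsMuK (CycleG n) k 2))
proposition4p1 k (suc (suc (suc m))) 1≤k 3≤N@(s≤s (s≤s (s≤s _))) = path-part , cycle-part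
  where
  open Cycle (suc (suc m))
  path-part : ∀ D → IsDiameter (PathG N) D → k ≤ D → IsMuK (PathG N) k 2
  path-part _ _ _ = IsMuK-pair PathG-sym (inj₁ refl) 1≤k path-∣S∣≤2
  cycle-part : ∀ D → IsDiameter C D → k ≤ D → (N ≤ 3 * k → IsMuK C k 3) × (¬ (N ≤ 3 * k) → IsMuK C k 2)
  cycle-part D diam k≤D = μ≡3 , λ N≰3k → IsMuK-pair CycleG-sym (inj₁ (inj₁ refl)) 1≤k (cycle-∣S∣≤2 N≰3k)
    where
    μ≡3 : N ≤ 3 * k → IsMuK C k 3
    μ≡3 N≤3k with mutually-visible-triple 1≤k 3≤N N≤3k (≤-trans (+-mono-≤ k≤D k≤D) (diameter-bound diam))
    ... | T , T-visible , 3≤∣T∣ = IsMuK-intro T-visible 3≤∣T∣ cycle-∣S∣≤3
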